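{- Let $m\ge2$ be an even integer. Suppose there exists an $\mathrm{OA}(\ell,r,s,r)_\lambda$ with symbols $0,1,\ldots,s-1$ and $s\ge m+1$. Suppose $A_1,\ldots,A_s,B_1,\ldots,B_s$ are rational numbers such that the $4s$ numbers $\pm A_1,\ldots,\pm A_s,\pm B_1,\ldots,\pm B_s$ are mutually distinct and (1) $[A_1,\ldots,A_s]=^s_m[B_1,\ldots,B_s]$, (2) $\sum_{i=1}^sA_i^{m+2}=\sum_{i=1}^sB_i^{m+2}$, (3) $\sum_{i=1}^sA_i=\sum_{i=1}^sB_i=0$. Let $X$ be the multiset of $2\ell$ vectors $\pm(A_{c_1+1},\ldots,A_{c_r+1})$, where $(c_1,\ldots,c_r)$ ranges over the rows of the orthogonal array, and let $Y$ be defined in the same way with $B$ in place of $A$. Then $(X,Y)$ is a proper $\mathrm{PTE}_r$ solution of degree $m+3$ and size $2\ell$.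
   Context: An orthogonal array $\mathrm{OA}(\ell,r,s,t)_\lambda$ is an $\ell\times r$ array with entries from a set of $s$ symbols such that in every $\ell\times t$ subarray each of the $s^t$ ordered $t$-tuples of symbols occurs as a row exactly $\lambda$ times. For multisets $A=\{\mathbf{a}_1,\ldots,\mathbf{a}_n\}$, $B=\{\mathbf{b}_1,\ldots,\mathbf{b}_n\}\subset\mathbb{Q}^r$ with $\mathbf{a}_i=(a_{i1},\ldots,a_{ir})$, $\mathbf{b}_i=(b_{i1},\ldots,b_{ir})$, $[A]=^n_m[B]$ (a $\mathrm{PTE}_r$ solution of degree $m$ and size $n$) means $A,B$ have no common element and $\sum_i\prod_j a_{ij}^{k_j}=\sum_i\prod_j b_{ij}^{k_j}$ for all nonnegative integers $k_j$ with $1\le\sum_jk_j\le m$; for $r=1$ this reads $\sum_i a_i^k=\sum_i b_i^k$ for $1\le k\le m$. A solution is proper if the $n\times r$ matrices with rows $\mathbf{a}_i$ resp. $\mathbf{b}_i$ both have rank $r$. -}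

module Defs where

open import Data.Nat as ℕ using (ℕ; zero; suc)
open import Data.Fin as Fin using (Fin; remQuot)
open import Data.Product using (_×_; _,_)
open import Data.Rational as ℚ using (ℚ; 0ℚ; 1ℚ)
open import Relation.Binary.PropositionalEquality using (_≡_)
open import Relation.Nullary using (¬_; Dec; yes; no)
open import Data.Fin.Properties using (all?; _≟_)

_^ℚ_ : ℚ → ℕ → ℚ
x ^ℚ zero  = 1ℚ
x ^ℚ suc n = x ℚ.* (x ^ℚ n)

Σℚ : (n : ℕ) → (Fin n → ℚ) → ℚ
Σℚ zero    f = 0ℚ
Σℚ (suc n) f = f Fin.zero ℚ.+ Σℚ n (λ i → f (Fin.suc i))

Πℚ : (n : ℕ) → (Fin n → ℚ) → ℚ
Πℚ zero    f = 1ℚ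
Πℚ (suc n) f = f Fin.zero ℚ.* Πℚ n (λ i → f (Fin.suc i))

Σℕ : (n : ℕ) → (Fin n → ℕ) → ℕ
Σℕ zero    f = 0
Σℕ (suc n) f = f Fin.zero ℕ.+ Σℕ n (λ i → f (Fin.suc i))

count : (n : ℕ) {P : Fin n → Set} → ((i : Fin n) → Dec (P i)) → ℕ
count zero    d = 0
count (suc n) d with d Fin.zero
... | yes _ = suc (count n (λ i → d (Fin.suc i)))
... | no  _ = count n (λ i → d (Fin.suc i))

-- An array is M : Fin ℓ → Fin r → Fin s (row i, column j).
-- An ℓ × t subarray is given by t columns cols 0 < … < t-1 (strictly
-- increasing), and every t-tuple of symbols must occur as a row of it
-- exactly λ times.

StrictlyIncreasing : {t r : ℕ} → (Fin t → Fin r) → Set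
StrictlyIncreasing {t} cols = ∀ (j k : Fin t) → j Fin.< k → cols j Fin.< cols k

rowMatches? : {ℓ r s t : ℕ} (M : Fin ℓ → Fin r → Fin s) (cols : Fin t → Fin r)
              (tuple : Fin t → Fin s) (i : Fin ℓ) →
              Dec (∀ j → M i (cols j) ≡ tuple j)
rowMatches? M cols tuple i = all? (λ j → M i (cols j) ≟ tuple j)

IsOA : (ℓ r s t λ′ : ℕ) → (Fin ℓ → Fin r → Fin s) → Set
IsOA ℓ r s t λ′ M =
  ∀ (cols : Fin t → Fin r) → StrictlyIncreasing cols →
  ∀ (tuple : Fin t → Fin s) →
  count ℓ (rowMatches? M cols tuple) ≡ λ′

-- PTE_r solutions.  A multiset {a_1,…,a_n} ⊂ ℚ^r is an indexed family
-- a : Fin n → (Fin r → ℚ) (a i j = a_{ij}).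

NoCommon : {n r : ℕ} → (Fin n → Fin r → ℚ) → (Fin n → Fin r → ℚ) → Set
NoCommon {n} {r} a b = ∀ (i i′ : Fin n) → ¬ (∀ (j : Fin r) → a i j ≡ b i′ j)

powSum : {n r : ℕ} → (Fin n → Fin r → ℚ) → (Fin r → ℕ) → ℚ
powSum {n} {r} a k = Σℚ n (λ i → Πℚ r (λ j → a i j ^ℚ k j))

IsPTE : (r n m : ℕ) → (Fin n → Fin r → ℚ) → (Fin n → Fin r → ℚ) → Set
IsPTE r n m a b =
  NoCommon a b ×
  (∀ (k : Fin r → ℕ) → 1 ℕ.≤ Σℕ r k → Σℕ r k ℕ.≤ m → powSum a k ≡ powSum b k)

-- the n × r matrix with rows a_i has rank r, i.e. its r columns are
-- linearly independent over ℚ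
HasRank : (n r : ℕ) → (Fin n → Fin r → ℚ) → Set
HasRank n r a =
  ∀ (c : Fin r → ℚ) → (∀ (i : Fin n) → Σℚ r (λ j → c j ℚ.* a i j) ≡ 0ℚ) →
  ∀ (j : Fin r) → c j ≡ 0ℚ

IsProperPTE : (r n m : ℕ) → (Fin n → Fin r → ℚ) → (Fin n → Fin r → ℚ) → Set
IsProperPTE r n m a b = IsPTE r n m a b × HasRank n r a × HasRank n r b

sgn : Fin 2 → ℚ → ℚ
sgn Fin.zero       x = x
sgn (Fin.suc _)    x = ℚ.- x

-- the 2ℓ vectors ±(A_{c_1+1}, …, A_{c_r+1}), (c_1,…,c_r) a row of M;
-- index (σ, i) ∈ Fin 2 × Fin ℓ encoded in Fin (2 * ℓ) via remQuot
signedRows : {ℓ r s : ℕ} → (Fin ℓ → Fin r → Fin s) → (Fin s → ℚ) →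
             Fin (2 ℕ.* ℓ) → Fin r → ℚ
signedRows {ℓ} M A idx j with remQuot {2} ℓ idx
... | (σ , i) = sgn σ (A (M i j))

-- the 4s numbers ±A_1,…,±A_s,±B_1,…,±B_s, indexed by (σ, τ, i)
plusMinusAB : {s : ℕ} → (Fin s → ℚ) → (Fin s → ℚ) → Fin 2 → Fin 2 → Fin s → ℚ
plusMinusAB A B σ Fin.zero    i = sgn σ (A i)
plusMinusAB A B σ (Fin.suc _) i = sgn σ (B i)

as1 : {s : ℕ} → (Fin s → ℚ) → Fin s → Fin 1 → ℚ
as1 A i _ = A i

-- Symmetrising under ± makes every odd-degree moment of X and of Y vanish,
-- and since m is even the remaining degrees K are even with K ≤ m + 2.  An
-- orthogonal array of strength r contains every r-tuple of symbols exactly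
-- λ times, so Σ_{x∈X} Π_j x_j^{k_j} = 2λ Π_j S_A(k_j), where S_A(e) is the
-- power sum Σ_a A_a^e; likewise for Y.  The hypotheses give S_A(e) = S_B(e)
-- for every e ≤ m + 2 except e = m + 1, and a factor of degree m + 1 in an
-- even total degree K ≤ m + 2 forces a second factor of degree 1, where
-- S_A(1) = S_B(1) = 0.  Properness follows because the array contains both
-- the row (x, …, x) and the row that differs from it only by y in column j,
-- and A_x ≠ A_y.

module Submission where

open import Defs
open import Data.Nat using (ℕ; _+_; _*_; _≤_)
open import Data.Nat.Divisibility using (_∣_)
open import Data.Fin using (Fin)
open import Data.Product using (_×_)
open import Data.Rational using (ℚ; 0ℚ)
open import Relation.Binary.PropositionalEquality using (_≡_)

open import Algebra.Bundles using (CommutativeRing)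
import Algebra.Properties.CommutativeMonoid.Sum
open import Data.Bool using (Bool; true; false; _∧_; if_then_else_)
open import Data.Fin using (zero; suc; _↑ˡ_; _↑ʳ_; remQuot; combine; fromℕ<)
open import Data.Fin.Properties using (_≟_; all?; remQuot-combine; splitAt-↑ʳ)
open import Data.Nat using (zero; suc; z≤n; s≤s; parity; _≤?_) renaming (_≟_ to _≟ℕ_)
open import Data.Nat.Divisibility using (divides)
open import Data.Nat.Properties
  using (≤-trans; ≤-antisym; ≤-pred; ≤∧≢⇒<; ≰⇒>; m≤m+n; m≤n+m; +-comm; +-identityʳ; +-cancelʳ-≤)
open import Data.Parity.Base as ℙ using (0ℙ; 1ℙ)
import Data.Parity.Properties as ℙₚ
open import Data.Product using (_,_; proj₁; proj₂; uncurry; ∃-syntax; ∃₂)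
import Data.Rational as ℚ
open import Data.Rational using (1ℚ)
import Data.Rational.Properties as ℚₚ
open import Data.Rational.Solver using (module +-*-Solver)
open import Data.Vec.Functional using (_∷_)
open import Function using (id; _∘_)
open import Relation.Binary.PropositionalEquality
  using (_≢_; refl; sym; trans; cong; cong₂; subst; ≢-sym; module ≡-Reasoning)
open import Relation.Nullary using (Dec; does; yes; no; contradiction)

open CommutativeRing ℚₚ.+-*-commutativeRing
  using (ring; semiring; commutativeSemiring; *-commutativeMonoid)
open import Algebra.Properties.Semiring.Sum semiring
  using (sum; sum-cong-≗; ∑-comm; ∑-distrib-+; *-distribˡ-sum; *-distribʳ-sum)
open import Algebra.Properties.CommutativeSemiring.Exp commutativeSemiring
  using (_^_; ^-homo-*; ^-distrib-*)
open import Algebra.Properties.Ring ring using (-1*x≈-x; -‿involutive; x∙y⁻¹≈ε⇒x≈y)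
open import Algebra.Apartness.Properties.HeytingCommutativeRing ℚₚ.heytingCommutativeRing
  using (x#0y#0→xy#0)
module Π = Algebra.Properties.CommutativeMonoid.Sum *-commutativeMonoid

Σℚ≡sum : ∀ n (f : Fin n → ℚ) → Σℚ n f ≡ sum f
Σℚ≡sum zero    f = refl
Σℚ≡sum (suc n) f = cong (f zero ℚ.+_) (Σℚ≡sum n (λ i → f (suc i)))

Σℚ-cong : ∀ n {f g : Fin n → ℚ} → (∀ i → f i ≡ g i) → Σℚ n f ≡ Σℚ n g
Σℚ-cong n {f} {g} f≗g =
  trans (Σℚ≡sum n f) (trans (sum-cong-≗ f≗g) (sym (Σℚ≡sum n g)))

Σℚ-comm : ∀ m n (f : Fin m → Fin n → ℚ) →
          Σℚ m (λ i → Σℚ n (f i)) ≡ Σℚ n (λ j → Σℚ m (λ i → f i j))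
Σℚ-comm m n f = trans (Σℚ²≡sum² m n f)
  (trans (∑-comm f) (sym (Σℚ²≡sum² n m (λ j i → f i j))))
  where
  Σℚ²≡sum² : ∀ m n (f : Fin m → Fin n → ℚ) →
             Σℚ m (λ i → Σℚ n (f i)) ≡ sum (λ i → sum (f i))
  Σℚ²≡sum² m n f =
    trans (Σℚ≡sum m _) (sum-cong-≗ (λ i → Σℚ≡sum n (f i)))

*-distribˡ-Σℚ : ∀ n x (f : Fin n → ℚ) → x ℚ.* Σℚ n f ≡ Σℚ n (λ i → x ℚ.* f i)
*-distribˡ-Σℚ n x f = trans (cong (x ℚ.*_) (Σℚ≡sum n f))
  (trans (*-distribˡ-sum x f) (sym (Σℚ≡sum n _)))

*-distribʳ-Σℚ : ∀ n x (f : Fin n → ℚ) → Σℚ n f ℚ.* x ≡ Σℚ n (λ i → f i ℚ.* x)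
*-distribʳ-Σℚ n x f = trans (cong (ℚ._* x) (Σℚ≡sum n f))
  (trans (*-distribʳ-sum x f) (sym (Σℚ≡sum n _)))

Σℚ-distrib-+ : ∀ n (f g : Fin n → ℚ) → Σℚ n (λ i → f i ℚ.+ g i) ≡ Σℚ n f ℚ.+ Σℚ n g
Σℚ-distrib-+ n f g = trans (Σℚ≡sum n _) (trans (∑-distrib-+ f g)
  (sym (cong₂ ℚ._+_ (Σℚ≡sum n f) (Σℚ≡sum n g))))

Σℚ-↑ : ∀ m n (f : Fin (m + n) → ℚ) →
       Σℚ (m + n) f ≡ Σℚ m (λ i → f (i ↑ˡ n)) ℚ.+ Σℚ n (λ j → f (m ↑ʳ j))
Σℚ-↑ zero    n f = sym (ℚₚ.+-identityˡ _)
Σℚ-↑ (suc m) n f = trans (cong (f zero ℚ.+_) (Σℚ-↑ m n (λ i → f (suc i))))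
  (sym (ℚₚ.+-assoc (f zero) _ _))

Σℚ-remQuot : ∀ m n (g : Fin m × Fin n → ℚ) →
             Σℚ (m * n) (λ x → g (remQuot n x)) ≡ Σℚ m (λ σ → Σℚ n (λ i → g (σ , i)))
Σℚ-remQuot zero    n g = refl
Σℚ-remQuot (suc m) n g = trans (Σℚ-↑ n (m * n) _) (cong₂ ℚ._+_
  (Σℚ-cong n (λ i → cong g (remQuot-combine zero i)))
  (trans (Σℚ-cong (m * n) (λ x → cong g (remQuot-↑ʳ x)))
         (Σℚ-remQuot m n (λ (σ , i) → g (suc σ , i)))))
  where
  remQuot-↑ʳ : ∀ x → remQuot {suc m} n (n ↑ʳ x) ≡ (suc (proj₁ (remQuot {m} n x)) , proj₂ (remQuot {m} n x))
  remQuot-↑ʳ x rewrite splitAt-↑ʳ n (m * n) x = refl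

Πℚ≡product : ∀ r (f : Fin r → ℚ) → Πℚ r f ≡ Π.sum f
Πℚ≡product zero    f = refl
Πℚ≡product (suc r) f = cong (f zero ℚ.*_) (Πℚ≡product r (λ j → f (suc j)))

Πℚ-cong : ∀ r {f g : Fin r → ℚ} → (∀ j → f j ≡ g j) → Πℚ r f ≡ Πℚ r g
Πℚ-cong r {f} {g} f≗g =
  trans (Πℚ≡product r f) (trans (Π.sum-cong-≗ f≗g) (sym (Πℚ≡product r g)))

Πℚ-distrib-* : ∀ r (f g : Fin r → ℚ) →
               Πℚ r (λ j → f j ℚ.* g j) ≡ Πℚ r f ℚ.* Πℚ r g
Πℚ-distrib-* r f g = trans (Πℚ≡product r _) (trans (Π.∑-distrib-+ f g)
  (sym (cong₂ ℚ._*_ (Πℚ≡product r f) (Πℚ≡product r g))))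

^ℚ≡^ : ∀ x n → x ^ℚ n ≡ x ^ n
^ℚ≡^ x zero    = refl
^ℚ≡^ x (suc n) = cong (x ℚ.*_) (^ℚ≡^ x n)

^ℚ-homo-+ : ∀ x m n → x ^ℚ (m + n) ≡ x ^ℚ m ℚ.* x ^ℚ n
^ℚ-homo-+ x m n = trans (^ℚ≡^ x (m + n)) (trans (^-homo-* x m n)
  (sym (cong₂ ℚ._*_ (^ℚ≡^ x m) (^ℚ≡^ x n))))

[-x]^ℚn≡[-1]^ℚn*x^ℚn : ∀ x n → (ℚ.- x) ^ℚ n ≡ (ℚ.- 1ℚ) ^ℚ n ℚ.* x ^ℚ n
[-x]^ℚn≡[-1]^ℚn*x^ℚn x n = begin
  (ℚ.- x) ^ℚ n                  ≡⟨ ^ℚ≡^ (ℚ.- x) n ⟩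
  (ℚ.- x) ^ n                   ≡⟨ cong (_^ n) (-1*x≈-x x) ⟨
  (ℚ.- 1ℚ ℚ.* x) ^ n            ≡⟨ ^-distrib-* (ℚ.- 1ℚ) x n ⟩
  (ℚ.- 1ℚ) ^ n ℚ.* x ^ n        ≡⟨ cong₂ ℚ._*_ (^ℚ≡^ (ℚ.- 1ℚ) n) (^ℚ≡^ x n) ⟨
  (ℚ.- 1ℚ) ^ℚ n ℚ.* x ^ℚ n      ∎
  where open ≡-Reasoning

Πℚ-^ℚ : ∀ r x (k : Fin r → ℕ) → Πℚ r (λ j → x ^ℚ k j) ≡ x ^ℚ Σℕ r k
Πℚ-^ℚ zero    x k = refl
Πℚ-^ℚ (suc r) x k = trans (cong (x ^ℚ k zero ℚ.*_) (Πℚ-^ℚ r x (λ j → k (suc j))))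
  (sym (^ℚ-homo-+ x (k zero) _))

Πℚ-neg-^ℚ : ∀ r (x : Fin r → ℚ) (k : Fin r → ℕ) →
            Πℚ r (λ j → (ℚ.- x j) ^ℚ k j) ≡ (ℚ.- 1ℚ) ^ℚ Σℕ r k ℚ.* Πℚ r (λ j → x j ^ℚ k j)
Πℚ-neg-^ℚ r x k = begin
  Πℚ r (λ j → (ℚ.- x j) ^ℚ k j)
    ≡⟨ Πℚ-cong r (λ j → [-x]^ℚn≡[-1]^ℚn*x^ℚn (x j) (k j)) ⟩
  Πℚ r (λ j → (ℚ.- 1ℚ) ^ℚ k j ℚ.* x j ^ℚ k j)
    ≡⟨ Πℚ-distrib-* r _ _ ⟩
  Πℚ r (λ j → (ℚ.- 1ℚ) ^ℚ k j) ℚ.* Πℚ r (λ j → x j ^ℚ k j)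
    ≡⟨ cong (ℚ._* Πℚ r (λ j → x j ^ℚ k j)) (Πℚ-^ℚ r (ℚ.- 1ℚ) k) ⟩
  (ℚ.- 1ℚ) ^ℚ Σℕ r k ℚ.* Πℚ r (λ j → x j ^ℚ k j)
    ∎
  where open ≡-Reasoning

Σtuple : ∀ r s → ((Fin r → Fin s) → ℚ) → ℚ
Σtuple zero    s G = G (λ ())
Σtuple (suc r) s G = Σℚ s (λ a → Σtuple r s (λ t → G (a ∷ t)))

Σtuple-cong : ∀ r s {G H : (Fin r → Fin s) → ℚ} → (∀ t → G t ≡ H t) →
              Σtuple r s G ≡ Σtuple r s H
Σtuple-cong zero    s G≗H = G≗H _
Σtuple-cong (suc r) s G≗H = Σℚ-cong s (λ a → Σtuple-cong r s (λ t → G≗H (a ∷ t)))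

*-distribˡ-Σtuple : ∀ r s x (G : (Fin r → Fin s) → ℚ) →
                    x ℚ.* Σtuple r s G ≡ Σtuple r s (λ t → x ℚ.* G t)
*-distribˡ-Σtuple zero    s x G = refl
*-distribˡ-Σtuple (suc r) s x G = trans (*-distribˡ-Σℚ s x _)
  (Σℚ-cong s (λ a → *-distribˡ-Σtuple r s x (λ t → G (a ∷ t))))

Σℚ-Σtuple-comm : ∀ n r s (h : Fin n → (Fin r → Fin s) → ℚ) →
                 Σℚ n (λ i → Σtuple r s (h i)) ≡ Σtuple r s (λ t → Σℚ n (λ i → h i t))
Σℚ-Σtuple-comm n zero    s h = refl
Σℚ-Σtuple-comm n (suc r) s h = trans (Σℚ-comm n s _)
  (Σℚ-cong s (λ a → Σℚ-Σtuple-comm n r s (λ i t → h i (a ∷ t))))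

Σtuple-Πℚ : ∀ r s (g : Fin r → Fin s → ℚ) →
            Σtuple r s (λ t → Πℚ r (λ j → g j (t j))) ≡ Πℚ r (λ j → Σℚ s (g j))
Σtuple-Πℚ zero    s g = refl
Σtuple-Πℚ (suc r) s g = begin
  Σℚ s (λ a → Σtuple r s (λ t → g zero a ℚ.* Πℚ r (λ j → g (suc j) (t j))))
    ≡⟨ Σℚ-cong s (λ a → sym (*-distribˡ-Σtuple r s (g zero a) _)) ⟩
  Σℚ s (λ a → g zero a ℚ.* Σtuple r s (λ t → Πℚ r (λ j → g (suc j) (t j))))
    ≡⟨ Σℚ-cong s (λ a → cong (g zero a ℚ.*_) (Σtuple-Πℚ r s (λ j → g (suc j)))) ⟩
  Σℚ s (λ a → g zero a ℚ.* Πℚ r (λ j → Σℚ s (g (suc j))))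
    ≡⟨ *-distribʳ-Σℚ s _ (g zero) ⟨
  Σℚ s (g zero) ℚ.* Πℚ r (λ j → Σℚ s (g (suc j)))
    ∎
  where open ≡-Reasoning

𝟙 : Bool → ℚ
𝟙 true  = 1ℚ
𝟙 false = 0ℚ

𝟙-∧ : ∀ b c → 𝟙 (b ∧ c) ≡ 𝟙 b ℚ.* 𝟙 c
𝟙-∧ true  c = sym (ℚₚ.*-identityˡ (𝟙 c))
𝟙-∧ false c = sym (ℚₚ.*-zeroˡ (𝟙 c))

Πℚ-𝟙 : ∀ r {P : Fin r → Set} (P? : ∀ j → Dec (P j)) →
       Πℚ r (λ j → 𝟙 (does (P? j))) ≡ 𝟙 (does (all? P?))
Πℚ-𝟙 zero    P? = refl
Πℚ-𝟙 (suc r) P? = trans (cong (𝟙 (does (P? zero)) ℚ.*_) (Πℚ-𝟙 r (λ j → P? (suc j))))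
  (sym (𝟙-∧ (does (P? zero)) _))

Σℚ-𝟙-≟ : ∀ s (u : Fin s) (g : Fin s → ℚ) → Σℚ s (λ a → 𝟙 (does (u ≟ a)) ℚ.* g a) ≡ g u
Σℚ-𝟙-≟ (suc s) zero    g = begin
  1ℚ ℚ.* g zero ℚ.+ Σℚ s (λ a → 0ℚ ℚ.* g (suc a))
    ≡⟨ cong₂ ℚ._+_ (sym (ℚₚ.*-identityˡ (g zero))) (*-distribˡ-Σℚ s 0ℚ (λ a → g (suc a))) ⟨
  g zero ℚ.+ 0ℚ ℚ.* Σℚ s (λ a → g (suc a))
    ≡⟨ cong (g zero ℚ.+_) (ℚₚ.*-zeroˡ (Σℚ s (λ a → g (suc a)))) ⟩
  g zero ℚ.+ 0ℚ
    ≡⟨ ℚₚ.+-identityʳ (g zero) ⟩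
  g zero
    ∎
  where open ≡-Reasoning
Σℚ-𝟙-≟ (suc s) (suc u) g = begin
  0ℚ ℚ.* g zero ℚ.+ Σℚ s (λ a → 𝟙 (does (u ≟ a)) ℚ.* g (suc a))
    ≡⟨ cong (ℚ._+ Σℚ s (λ a → 𝟙 (does (u ≟ a)) ℚ.* g (suc a))) (ℚₚ.*-zeroˡ (g zero)) ⟩
  0ℚ ℚ.+ Σℚ s (λ a → 𝟙 (does (u ≟ a)) ℚ.* g (suc a))
    ≡⟨ ℚₚ.+-identityˡ _ ⟩
  Σℚ s (λ a → 𝟙 (does (u ≟ a)) ℚ.* g (suc a))
    ≡⟨ Σℚ-𝟙-≟ s u (λ a → g (suc a)) ⟩
  g (suc u)
    ∎
  where open ≡-Reasoning

Σℚ-𝟙-count : ∀ n {P : Fin n → Set} (P? : ∀ i → Dec (P i)) x →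
             Σℚ n (λ i → 𝟙 (does (P? i)) ℚ.* x) ≡ Σℚ (count n P?) (λ _ → x)
Σℚ-𝟙-count zero    P? x = refl
Σℚ-𝟙-count (suc n) P? x with P? zero
... | yes _ = cong₂ ℚ._+_ (ℚₚ.*-identityˡ x) (Σℚ-𝟙-count n (λ i → P? (suc i)) x)
... | no  _ = trans (cong (ℚ._+ Σℚ n (λ i → 𝟙 (does (P? (suc i))) ℚ.* x)) (ℚₚ.*-zeroˡ x))
  (trans (ℚₚ.+-identityˡ _) (Σℚ-𝟙-count n (λ i → P? (suc i)) x))

-- Each factor g j (M i j) is expanded as Σ_a [M i j = a] g j a; multiplying
-- out turns row i into Σ_t [M i = t] G t, and every t is a row λ′ times.
IsOA⇒Σℚ-Πℚ : ∀ {ℓ r s λ′} (M : Fin ℓ → Fin r → Fin s) → IsOA ℓ r s r λ′ M →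
             (g : Fin r → Fin s → ℚ) →
             Σℚ ℓ (λ i → Πℚ r (λ j → g j (M i j))) ≡ Σℚ λ′ (λ _ → Πℚ r (λ j → Σℚ s (g j)))
IsOA⇒Σℚ-Πℚ {ℓ} {r} {s} {λ′} M oa g = begin
  Σℚ ℓ (λ i → Πℚ r (λ j → g j (M i j)))
    ≡⟨ Σℚ-cong ℓ (λ i → Πℚ-cong r (λ j → Σℚ-𝟙-≟ s (M i j) (g j))) ⟨
  Σℚ ℓ (λ i → Πℚ r (λ j → Σℚ s (λ a → 𝟙 (does (M i j ≟ a)) ℚ.* g j a)))
    ≡⟨ Σℚ-cong ℓ (λ i → Σtuple-Πℚ r s (λ j a → 𝟙 (does (M i j ≟ a)) ℚ.* g j a)) ⟨
  Σℚ ℓ (λ i → Σtuple r s (λ t → Πℚ r (λ j → 𝟙 (does (M i j ≟ t j)) ℚ.* g j (t j))))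
    ≡⟨ Σℚ-cong ℓ (λ i → Σtuple-cong r s (λ t → matches i t)) ⟩
  Σℚ ℓ (λ i → Σtuple r s (λ t → 𝟙 (does (rowMatches? M id t i)) ℚ.* G t))
    ≡⟨ Σℚ-Σtuple-comm ℓ r s _ ⟩
  Σtuple r s (λ t → Σℚ ℓ (λ i → 𝟙 (does (rowMatches? M id t i)) ℚ.* G t))
    ≡⟨ Σtuple-cong r s (λ t → trans (Σℚ-𝟙-count ℓ (rowMatches? M id t) (G t))
                                    (cong (λ c → Σℚ c (λ _ → G t)) (oa id (λ _ _ j<k → j<k) t))) ⟩
  Σtuple r s (λ t → Σℚ λ′ (λ _ → G t))
    ≡⟨ Σℚ-Σtuple-comm λ′ r s (λ _ → G) ⟨
  Σℚ λ′ (λ _ → Σtuple r s G)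
    ≡⟨ Σℚ-cong λ′ (λ _ → Σtuple-Πℚ r s g) ⟩
  Σℚ λ′ (λ _ → Πℚ r (λ j → Σℚ s (g j)))
    ∎
  where
  open ≡-Reasoning
  G : (Fin r → Fin s) → ℚ
  G t = Πℚ r (λ j → g j (t j))
  matches : ∀ i t → Πℚ r (λ j → 𝟙 (does (M i j ≟ t j)) ℚ.* g j (t j)) ≡ 𝟙 (does (rowMatches? M id t i)) ℚ.* G t
  matches i t = trans (Πℚ-distrib-* r _ _) (cong (ℚ._* G t) (Πℚ-𝟙 r (λ j → M i j ≟ t j)))

1≤count⇒∃ : ∀ n {P : Fin n → Set} (P? : ∀ i → Dec (P i)) → 1 ≤ count n P? → ∃[ i ] P i
1≤count⇒∃ (suc n) P? 1≤c with P? zero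
... | yes p = zero , p
... | no  _ = let i , p = 1≤count⇒∃ n (λ i → P? (suc i)) 1≤c in suc i , p

IsOA⇒allTuples : ∀ {ℓ r s λ′} (M : Fin ℓ → Fin r → Fin s) → IsOA ℓ r s r λ′ M → 1 ≤ λ′ →
                 ∀ t → ∃[ i ] (∀ j → M i j ≡ t j)
IsOA⇒allTuples {ℓ} M oa 1≤λ′ t =
  1≤count⇒∃ ℓ (rowMatches? M id t) (subst (1 ≤_) (sym (oa id (λ _ _ j<k → j<k) t)) 1≤λ′)

signedRows-combine : ∀ {ℓ r s} (M : Fin ℓ → Fin r → Fin s) A σ i j →
                     signedRows M A (combine σ i) j ≡ sgn σ (A (M i j))
signedRows-combine {ℓ} M A σ i j =
  cong (λ (σ , i) → sgn σ (A (M i j))) (remQuot-combine {k = ℓ} σ i)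

powSum-signedRows : ∀ {ℓ r s} (M : Fin ℓ → Fin r → Fin s) A (k : Fin r → ℕ) →
  powSum (signedRows M A) k ≡
  (1ℚ ℚ.+ (ℚ.- 1ℚ) ^ℚ Σℕ r k) ℚ.* Σℚ ℓ (λ i → Πℚ r (λ j → A (M i j) ^ℚ k j))
powSum-signedRows {ℓ} {r} M A k = begin
  Σℚ (2 * ℓ) (λ x → Πℚ r (λ j → signedRows M A x j ^ℚ k j))
    ≡⟨ Σℚ-remQuot 2 ℓ (λ (σ , i) → Πℚ r (λ j → sgn σ (A (M i j)) ^ℚ k j)) ⟩
  P ℚ.+ (Σℚ ℓ (λ i → Πℚ r (λ j → (ℚ.- A (M i j)) ^ℚ k j)) ℚ.+ 0ℚ)
    ≡⟨ cong (P ℚ.+_) (ℚₚ.+-identityʳ _) ⟩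
  P ℚ.+ Σℚ ℓ (λ i → Πℚ r (λ j → (ℚ.- A (M i j)) ^ℚ k j))
    ≡⟨ cong (P ℚ.+_) (Σℚ-cong ℓ (λ i → Πℚ-neg-^ℚ r (λ j → A (M i j)) k)) ⟩
  P ℚ.+ Σℚ ℓ (λ i → ε ℚ.* Πℚ r (λ j → A (M i j) ^ℚ k j))
    ≡⟨ cong₂ ℚ._+_ (ℚₚ.*-identityˡ P) (*-distribˡ-Σℚ ℓ ε _) ⟨
  1ℚ ℚ.* P ℚ.+ ε ℚ.* P
    ≡⟨ ℚₚ.*-distribʳ-+ P 1ℚ ε ⟨
  (1ℚ ℚ.+ ε) ℚ.* P
    ∎
  where
  open ≡-Reasoning
  ε = (ℚ.- 1ℚ) ^ℚ Σℕ r k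
  P = Σℚ ℓ (λ i → Πℚ r (λ j → A (M i j) ^ℚ k j))

1+-1^ℚ-odd≡0 : ∀ n → parity n ≡ 1ℙ → 1ℚ ℚ.+ (ℚ.- 1ℚ) ^ℚ n ≡ 0ℚ
1+-1^ℚ-odd≡0 (suc zero)    _   = refl
1+-1^ℚ-odd≡0 (suc (suc n)) odd = trans (cong (1ℚ ℚ.+_) -1*[-1*x]≡x) (1+-1^ℚ-odd≡0 n odd)
  where
  x = (ℚ.- 1ℚ) ^ℚ n
  -1*[-1*x]≡x : ℚ.- 1ℚ ℚ.* (ℚ.- 1ℚ ℚ.* x) ≡ x
  -1*[-1*x]≡x = trans (cong (ℚ.- 1ℚ ℚ.*_) (-1*x≈-x x))
    (trans (-1*x≈-x (ℚ.- x)) (-‿involutive x))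

Σpow : ∀ {s} → (Fin s → ℚ) → ℕ → ℚ
Σpow {s} A e = Σℚ s (λ a → A a ^ℚ e)

signedRows-PTE : ∀ {ℓ r s λ′} d (M : Fin ℓ → Fin r → Fin s) → IsOA ℓ r s r λ′ M →
  (A B : Fin s → ℚ) →
  (∀ k → parity (Σℕ r k) ≡ 0ℙ → Σℕ r k ≤ d →
         Πℚ r (λ j → Σpow A (k j)) ≡ Πℚ r (λ j → Σpow B (k j))) →
  ∀ k → Σℕ r k ≤ d → powSum (signedRows M A) k ≡ powSum (signedRows M B) k
signedRows-PTE {ℓ} {r} {s} {λ′} d M oa A B even-agree k K≤d =
  trans (powSum-signedRows M A k)
    (trans (cases (parity K) refl) (sym (powSum-signedRows M B k)))
  where
  K = Σℕ r k
  rowSum : (Fin s → ℚ) → ℚ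
  rowSum X = Σℚ ℓ (λ i → Πℚ r (λ j → X (M i j) ^ℚ k j))
  cases : ∀ p → parity K ≡ p →
          (1ℚ ℚ.+ (ℚ.- 1ℚ) ^ℚ K) ℚ.* rowSum A ≡ (1ℚ ℚ.+ (ℚ.- 1ℚ) ^ℚ K) ℚ.* rowSum B
  cases 0ℙ even = cong ((1ℚ ℚ.+ (ℚ.- 1ℚ) ^ℚ K) ℚ.*_) (begin
    rowSum A
      ≡⟨ IsOA⇒Σℚ-Πℚ M oa (λ j a → A a ^ℚ k j) ⟩
    Σℚ λ′ (λ _ → Πℚ r (λ j → Σpow A (k j)))
      ≡⟨ Σℚ-cong λ′ (λ _ → even-agree k even K≤d) ⟩
    Σℚ λ′ (λ _ → Πℚ r (λ j → Σpow B (k j)))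
      ≡⟨ IsOA⇒Σℚ-Πℚ M oa (λ j b → B b ^ℚ k j) ⟨
    rowSum B
      ∎)
    where open ≡-Reasoning
  cases 1ℙ odd = begin
    (1ℚ ℚ.+ (ℚ.- 1ℚ) ^ℚ K) ℚ.* rowSum A   ≡⟨ cong (ℚ._* rowSum A) (1+-1^ℚ-odd≡0 K odd) ⟩
    0ℚ ℚ.* rowSum A                        ≡⟨ ℚₚ.*-zeroˡ (rowSum A) ⟩
    0ℚ                                     ≡⟨ ℚₚ.*-zeroˡ (rowSum B) ⟨
    0ℚ ℚ.* rowSum B                        ≡⟨ cong (ℚ._* rowSum B) (1+-1^ℚ-odd≡0 K odd) ⟨
    (1ℚ ℚ.+ (ℚ.- 1ℚ) ^ℚ K) ℚ.* rowSum B   ∎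
    where open ≡-Reasoning

signedRows-allTuples : ∀ {ℓ r s λ′} (M : Fin ℓ → Fin r → Fin s) → IsOA ℓ r s r λ′ M → 1 ≤ λ′ →
  (A : Fin s → ℚ) → ∀ t → ∃[ i ] (∀ j → signedRows M A i j ≡ A (t j))
signedRows-allTuples M oa 1≤λ′ A t with IsOA⇒allTuples M oa 1≤λ′ t
... | i , Mᵢ≗t = combine {2} zero i , λ j → trans (signedRows-combine M A zero i j) (cong A (Mᵢ≗t j))

signedRows-noCommon : ∀ {ℓ r s} (M : Fin ℓ → Fin r → Fin s) (A B : Fin s → ℚ) → Fin r →
  (∀ σ a σ′ b → sgn σ (A a) ≢ sgn σ′ (B b)) → NoCommon (signedRows M A) (signedRows M B)
signedRows-noCommon {ℓ} M A B j ±A≢±B x x′ x≡x′ =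
  ±A≢±B (proj₁ (remQuot ℓ x)) (M (proj₂ (remQuot ℓ x)) j)
        (proj₁ (remQuot ℓ x′)) (M (proj₂ (remQuot ℓ x′)) j) (x≡x′ j)

m+n≤1+n∧≢n⇒m≡1 : ∀ m n → m + n ≤ suc n → m + n ≢ n → m ≡ 1
m+n≤1+n∧≢n⇒m≡1 zero          n _ m+n≢n = contradiction refl m+n≢n
m+n≤1+n∧≢n⇒m≡1 (suc zero)    n _ _     = refl
m+n≤1+n∧≢n⇒m≡1 (suc (suc m)) n le _    with +-cancelʳ-≤ n (2 + m) 1 le
... | s≤s ()

Σℕ≡1⇒∃≡1 : ∀ r (k : Fin r → ℕ) → Σℕ r k ≡ 1 → ∃[ j ] k j ≡ 1
Σℕ≡1⇒∃≡1 (suc r) k K≡1 with k zero in k₀≡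
... | zero     = let j , kⱼ≡1 = Σℕ≡1⇒∃≡1 r (k ∘ suc) K≡1 in suc j , kⱼ≡1
... | suc zero = zero , k₀≡

Πℚ-zero : ∀ r (f : Fin r → ℚ) j → f j ≡ 0ℚ → Πℚ r f ≡ 0ℚ
Πℚ-zero (suc r) f zero    f₀≡0 =
  trans (cong (ℚ._* Πℚ r (f ∘ suc)) f₀≡0) (ℚₚ.*-zeroˡ (Πℚ r (f ∘ suc)))
Πℚ-zero (suc r) f (suc j) fⱼ≡0 =
  trans (cong (f zero ℚ.*_) (Πℚ-zero r (f ∘ suc) j fⱼ≡0)) (ℚₚ.*-zeroʳ (f zero))

module _ {SA SB : ℕ → ℚ} {n : ℕ}
         (agree : ∀ e → e ≤ suc n → e ≢ n → SA e ≡ SB e)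
         (SA1≡0 : SA 1 ≡ 0ℚ) (SB1≡0 : SB 1 ≡ 0ℚ) where

  both-vanish : ∀ r (k : Fin r → ℕ) j → k j ≡ 1 →
                Πℚ r (λ j → SA (k j)) ≡ Πℚ r (λ j → SB (k j))
  both-vanish r k j kⱼ≡1 = trans (Πℚ-zero r _ j (trans (cong SA kⱼ≡1) SA1≡0))
                                 (sym (Πℚ-zero r _ j (trans (cong SB kⱼ≡1) SB1≡0)))

  -- A factor of degree n leaves total degree at most 1 to the others, and
  -- total degree exactly n is excluded, so some factor has degree 1.
  Πℚ-agree : ∀ r (k : Fin r → ℕ) → Σℕ r k ≤ suc n → Σℕ r k ≢ n →
             Πℚ r (λ j → SA (k j)) ≡ Πℚ r (λ j → SB (k j))
  Πℚ-agree zero    k _   _   = refl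
  Πℚ-agree (suc r) k K≤ K≢ with k zero ≟ℕ n | Σℕ r (k ∘ suc) ≟ℕ n
  ... | yes k₀≡n | _        =
    let j , kⱼ≡1 = Σℕ≡1⇒∃≡1 r (k ∘ suc) (m+n≤1+n∧≢n⇒m≡1 _ n (subst (_≤ suc n) K≡K′+n K≤)
                                                             (K≢ ∘ trans K≡K′+n))
    in both-vanish (suc r) k (suc j) kⱼ≡1
    where
    K≡K′+n : Σℕ (suc r) k ≡ Σℕ r (k ∘ suc) + n
    K≡K′+n = trans (cong (_+ Σℕ r (k ∘ suc)) k₀≡n) (+-comm n _)
  ... | no  k₀≢n | yes K′≡n =
    both-vanish (suc r) k zero (m+n≤1+n∧≢n⇒m≡1 (k zero) n (subst (_≤ suc n) K≡k₀+n K≤)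
                                                            (K≢ ∘ trans K≡k₀+n))
    where
    K≡k₀+n : Σℕ (suc r) k ≡ k zero + n
    K≡k₀+n = cong (k zero +_) K′≡n
  ... | no  k₀≢n | no  K′≢n = cong₂ ℚ._*_
    (agree (k zero) (≤-trans (m≤m+n (k zero) _) K≤) k₀≢n)
    (Πℚ-agree r (k ∘ suc) (≤-trans (m≤n+m _ (k zero)) K≤) K′≢n)

Σpow-agree : ∀ {s m} (A B : Fin s → ℚ) → IsPTE 1 s m (as1 A) (as1 B) →
  Σpow A (suc (suc m)) ≡ Σpow B (suc (suc m)) →
  ∀ e → e ≤ suc (suc m) → e ≢ suc m → Σpow A e ≡ Σpow B e
Σpow-agree A B pte top zero _ _ = refl
Σpow-agree {s} {m} A B (_ , pte) top (suc e) e≤ e≢ with suc e ≤? m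
... | yes e≤m = begin
  Σpow A (suc e)                          ≡⟨ Σℚ-cong s (λ a → ℚₚ.*-identityʳ (A a ^ℚ suc e)) ⟨
  powSum (as1 A) (λ _ → suc e)            ≡⟨ pte (λ _ → suc e) (s≤s z≤n) (subst (_≤ m) (sym (+-identityʳ (suc e))) e≤m) ⟩
  powSum (as1 B) (λ _ → suc e)            ≡⟨ Σℚ-cong s (λ b → ℚₚ.*-identityʳ (B b ^ℚ suc e)) ⟩
  Σpow B (suc e)                          ∎
  where open ≡-Reasoning
... | no  e≰m = subst (λ e → Σpow A e ≡ Σpow B e) (≤-antisym (≤∧≢⇒< (≰⇒> e≰m) (≢-sym e≢)) e≤) top

parity-even : ∀ {m} → 2 ∣ m → parity m ≡ 0ℙ
parity-even (divides p refl) = trans (ℙₚ.*-homo-* p 2) (ℙₚ.*-zeroʳ (parity p))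

parity-even⇒≢suc : ∀ {K n} → parity K ≡ 0ℙ → parity n ≡ 0ℙ → K ≢ suc n
parity-even⇒≢suc {K} {n} K-even n-even K≡1+n = 0ℙ≢1ℙ (begin
  0ℙ                 ≡⟨ K-even ⟨
  parity K           ≡⟨ cong parity K≡1+n ⟩
  parity (1 + n)     ≡⟨ ℙₚ.+-homo-+ 1 n ⟩
  1ℙ ℙ.+ parity n    ≡⟨ cong (1ℙ ℙ.+_) n-even ⟩
  1ℙ                 ∎)
  where
  open ≡-Reasoning
  0ℙ≢1ℙ : 0ℙ ≢ 1ℙ
  0ℙ≢1ℙ ()

even-degree-bound : ∀ {m K} → parity m ≡ 0ℙ → parity K ≡ 0ℙ → K ≤ m + 3 →
                    K ≤ suc (suc m) × K ≢ suc m
even-degree-bound {m} {K} m-even K-even K≤m+3 =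
  ≤-pred (≤∧≢⇒< (subst (K ≤_) (+-comm m 3) K≤m+3) (parity-even⇒≢suc {n = 2 + m} K-even m-even)) ,
  parity-even⇒≢suc K-even m-even

x*y≡0∧y≢0⇒x≡0 : ∀ x y → x ℚ.* y ≡ 0ℚ → y ≢ 0ℚ → x ≡ 0ℚ
x*y≡0∧y≢0⇒x≡0 x y xy≡0 y≢0 with x ℚₚ.≟ 0ℚ
... | yes x≡0 = x≡0
... | no  x≢0 = contradiction xy≡0 (x#0y#0→xy#0 x≢0 y≢0)

allTuples⇒HasRank : ∀ {n r s} (a : Fin n → Fin r → ℚ) (A : Fin s → ℚ) {x y : Fin s} →
  A x ≢ A y → (∀ (t : Fin r → Fin s) → ∃[ i ] (∀ j → a i j ≡ A (t j))) → HasRank n r a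
allTuples⇒HasRank {n} {r} {s} a A {x} {y} Ax≢Ay occurs c c·a≡0 j₀ =
  x*y≡0∧y≢0⇒x≡0 (c j₀) (A y ℚ.- A x) cⱼ₀[Ay-Ax]≡0 (≢-sym Ax≢Ay ∘ x∙y⁻¹≈ε⇒x≈y (A y) (A x))
  where
  combination : (Fin r → Fin s) → ℚ
  combination t = Σℚ r (λ j → c j ℚ.* A (t j))
  combination≡0 : ∀ t → combination t ≡ 0ℚ
  combination≡0 t with occurs t
  ... | i , aᵢ≗A∘t = trans (Σℚ-cong r (λ j → cong (c j ℚ.*_) (sym (aᵢ≗A∘t j)))) (c·a≡0 i)
  e : Fin r → Fin s
  e j = if does (j₀ ≟ j) then y else x
  d : Fin r → ℚ
  d j = c j ℚ.* (A y ℚ.- A x)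
  split : ∀ j → c j ℚ.* A (e j) ≡ c j ℚ.* A x ℚ.+ 𝟙 (does (j₀ ≟ j)) ℚ.* d j
  split j with does (j₀ ≟ j)
  ... | true  = solve 3 (λ c u v → c :* v := c :* u :+ con 1ℚ :* (c :* (v :- u))) refl (c j) (A x) (A y)
    where open +-*-Solver
  ... | false = solve 3 (λ c u v → c :* u := c :* u :+ con 0ℚ :* (c :* (v :- u))) refl (c j) (A x) (A y)
    where open +-*-Solver
  picked : ℚ
  picked = Σℚ r (λ j → 𝟙 (does (j₀ ≟ j)) ℚ.* d j)
  cⱼ₀[Ay-Ax]≡0 : d j₀ ≡ 0ℚ
  cⱼ₀[Ay-Ax]≡0 = begin
    d j₀                                         ≡⟨ Σℚ-𝟙-≟ r j₀ d ⟨
    picked                                       ≡⟨ ℚₚ.+-identityˡ picked ⟨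
    0ℚ ℚ.+ picked                                ≡⟨ cong (ℚ._+ picked) (combination≡0 (λ _ → x)) ⟨
    combination (λ _ → x) ℚ.+ picked             ≡⟨ Σℚ-distrib-+ r _ _ ⟨
    Σℚ r (λ j → c j ℚ.* A x ℚ.+ 𝟙 (does (j₀ ≟ j)) ℚ.* d j)
                                                 ≡⟨ Σℚ-cong r split ⟨
    combination e                                ≡⟨ combination≡0 e ⟩
    0ℚ                                           ∎
    where open ≡-Reasoning

two-symbols : ∀ {s} → 2 ≤ s → ∃₂ λ (x y : Fin s) → x ≢ y
two-symbols (s≤s (s≤s _)) = zero , suc zero , λ ()

theorem5p1 : (m ℓ r s λ′ : ℕ) → 2 ≤ m → 2 ∣ m → 1 ≤ r → 1 ≤ λ′ →
    (M : Fin ℓ → Fin r → Fin s) → IsOA ℓ r s r λ′ M → m + 1 ≤ s →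
    (A B : Fin s → ℚ) →
    (∀ σ τ i σ′ τ′ i′ → plusMinusAB A B σ τ i ≡ plusMinusAB A B σ′ τ′ i′ →
      (σ ≡ σ′) × (τ ≡ τ′) × (i ≡ i′)) →
    IsPTE 1 s m (as1 A) (as1 B) →
    Σℚ s (λ i → A i ^ℚ (m + 2)) ≡ Σℚ s (λ i → B i ^ℚ (m + 2)) →
    Σℚ s A ≡ 0ℚ → Σℚ s B ≡ 0ℚ →
    IsProperPTE r (2 * ℓ) (m + 3) (signedRows M A) (signedRows M B)
theorem5p1 m ℓ r s λ′ 2≤m 2∣m 1≤r 1≤λ′ M oa m+1≤s A B distinct pte top ΣA≡0 ΣB≡0
  with two-symbols (≤-trans 2≤m (≤-trans (m≤m+n m 1) m+1≤s))
... | x , y , x≢y =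
  (signedRows-noCommon M A B (fromℕ< 1≤r) ±A≢±B ,
   λ k _ → signedRows-PTE (m + 3) M oa A B even-agree k) ,
  allTuples⇒HasRank _ A (x≢y ∘ injective zero) (signedRows-allTuples M oa 1≤λ′ A) ,
  allTuples⇒HasRank _ B (x≢y ∘ injective (suc zero)) (signedRows-allTuples M oa 1≤λ′ B)
  where
  injective : ∀ τ {a b} → plusMinusAB A B zero τ a ≡ plusMinusAB A B zero τ b → a ≡ b
  injective τ = proj₂ ∘ proj₂ ∘ distinct zero τ _ zero τ _
  ±A≢±B : ∀ σ a σ′ b → sgn σ (A a) ≢ sgn σ′ (B b)
  ±A≢±B σ a σ′ b ±a≡±b with distinct σ zero a σ′ (suc zero) b ±a≡±b
  ... | _ , () , _
  Σpow1≡0 : ∀ X → Σℚ s X ≡ 0ℚ → Σpow X 1 ≡ 0ℚ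
  Σpow1≡0 X ΣX≡0 = trans (Σℚ-cong s (λ a → ℚₚ.*-identityʳ (X a))) ΣX≡0
  power-sums-agree : ∀ e → e ≤ suc (suc m) → e ≢ suc m → Σpow A e ≡ Σpow B e
  power-sums-agree = Σpow-agree A B pte (subst (λ e → Σpow A e ≡ Σpow B e) (+-comm m 2) top)
  even-agree : ∀ k → parity (Σℕ r k) ≡ 0ℙ → Σℕ r k ≤ m + 3 →
               Πℚ r (λ j → Σpow A (k j)) ≡ Πℚ r (λ j → Σpow B (k j))
  even-agree k K-even K≤m+3 =
    uncurry (Πℚ-agree power-sums-agree (Σpow1≡0 A ΣA≡0) (Σpow1≡0 B ΣB≡0) r k)
            (even-degree-bound (parity-even 2∣m) K-even K≤m+3)
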